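{- For any positive integer $t$ and nonnegative integers $a, b$ with $0 < a + b \le t$, the one-way deterministic communication complexity of $\textsc{avoid}(t,a,b)$ satisfies \[ D^{\to}(\textsc{avoid}(t,a,b)) \le \log\left( \binom{t}{a} \Big/ \binom{t-b}{a} \right) + \log\left( \ln \binom{t}{a} \right) + 2. \]
   Context: $\log$ denotes the base-2 logarithm and $[t]=\{1,\dots,t\}$. The one-way communication game $\textsc{avoid}(t,a,b)$: Alice is given a set $S \subseteq [t]$ with $|S| = a$; Bob, who has no input, must output a set $T \subseteq [t]$ with $|T| = b$ and $T \cap S = \varnothing$. In a one-way deterministic protocol, Alice sends a single message depending only on her input, and Bob outputs a function of that message; the protocol must always produce a valid output. Its cost is the maximum message length in bits over all inputs, and $D^{\to}(g)$ is the minimum cost of such a protocol for $g$. -}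

module Defs where

open import Data.Nat using (ℕ; zero; suc; _+_; _*_; _∸_; _^_; _≤_)
open import Data.Nat.Combinatorics using (_C_)
open import Data.Nat.Base using (_!)
open import Data.Bool using (Bool)
open import Data.List using (List; length)
open import Data.Fin.Subset using (Subset; ∣_∣; _∩_; ⊥)
open import Data.Product using (Σ; _×_)
open import Relation.Binary.PropositionalEquality using (_≡_)

-- Scaled partial sums of the exponential series at the rational x = P / Q:
--   expSeriesNum P Q K  =  Q ^ K * K ! * (Σ_{k<K} x ^ k / k !).
expSeriesNum : ℕ → ℕ → ℕ → ℕ
expSeriesNum P Q zero    = 0
expSeriesNum P Q (suc K) = suc K * Q * (expSeriesNum P Q K + P ^ K)

-- exp (P / Q) ≤ R  (for Q > 0), i.e. every partial sum of the exponential
-- series at P / Q is at most R, cleared of denominators Q ^ K * K !.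
ExpFracLeq : ℕ → ℕ → ℕ → Set
ExpFracLeq P Q R = ∀ K → expSeriesNum P Q K ≤ R * Q ^ K * K !

-- The real inequality
--   c ≤ log (C(t,a) / C(t-b,a)) + log (ln C(t,a)) + 2
-- rewritten (for C(t,a) ≥ 2, C(t-b,a) ≥ 1) as
--   exp (2 ^ c * C(t-b,a) / (4 * C(t,a))) ≤ C(t,a).
BoundHolds : ℕ → ℕ → ℕ → ℕ → Set
BoundHolds t a b c = ExpFracLeq (2 ^ c * ((t ∸ b) C a)) (4 * (t C a)) (t C a)

Protocol : (t a b c : ℕ) → Set
Protocol t a b c =
  Σ (Subset t → List Bool) λ alice →
  Σ (List Bool → Subset t) λ bob →
  ∀ (S : Subset t) → ∣ S ∣ ≡ a →
    (length (alice S) ≤ c) × (∣ bob (alice S) ∣ ≡ b) × (S ∩ bob (alice S) ≡ ⊥)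

{-# OPTIONS --safe #-}
-- Alice and Bob fix b-sets T₁, …, Tₘ such that every a-set is disjoint from some Tᵢ,
-- and Alice sends such an index i in c bits, where m ≤ 2 ^ c.
-- Let N = C(t,a), D = C(t-b,a) and E = N - D.  A fixed a-set is disjoint from C(t-a,b)
-- of the C(t,b) b-sets, and C(t-a,b) / C(t,b) = D / N, so by averaging every family of
-- a-sets has a b-set disjoint from a D/N fraction of it.  Choosing such b-sets greedily
-- leaves at most N (E/N) ^ m a-sets uncovered after m rounds.  Take μ ≥ 1 with
-- N (E/N) ^ μ ≥ 1 > N (E/N) ^ (μ+1): then μ + 1 rounds cover everything, and since
-- exp x ≤ 1 / (1 - x) for x = D/N, exp (μ D/N) ≤ (N/E) ^ μ ≤ N.  With μ + 1 ≤ 2 ^ c ≤ 2 μ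
-- this gives exp (2 ^ c D / 4N) ≤ N, the form of the bound in BoundHolds.
module Submission where

open import Defs
open import Data.Bool using (Bool; true; false; if_then_else_)
import Data.Bool.Properties as Bool
open import Data.Empty using (⊥-elim)
open import Data.Fin.Subset using (Subset; inside; outside; ⊥; _∩_; ∣_∣)
open import Data.Fin.Subset.Properties using (∣⊥∣≡0; ∣p∣≤n; ∩-zeroʳ)
open import Data.List using (List; []; _∷_; [_]; _++_; map; length; filter)
open import Data.List.Properties using (length-map; length-++; map-++; map-∘)
open import Data.List.Membership.Propositional using (_∈_)
open import Data.List.Membership.Propositional.Properties using (∈-map⁺; ∈-++⁺ˡ; ∈-++⁺ʳ; ∈-filter⁺)
open import Data.List.Relation.Unary.All as All using (All; []; _∷_)
open import Data.List.Relation.Unary.All.Properties using (map⁺; ++⁺; filter⁺)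
open import Data.List.Relation.Unary.Any using (Any; here; there)
open import Data.List.Relation.Unary.Any.Properties using (¬Any[])
open import Data.Nat
open import Data.Nat.Combinatorics
  using (_C_; nCk≡n!/k![n-k]!; k![n∸k]!∣n!; nCk+nC[k+1]≡[n+1]C[k+1]; k>n⇒nCk≡0)
open import Data.Nat.DivMod using (m/n*n≡m)
open import Data.Nat.ListAction using (sum)
open import Data.Nat.ListAction.Properties using (sum-++)
open import Data.Nat.Properties
open import Algebra.Properties.CommutativeSemigroup *-commutativeSemigroup using (x∙yz≈y∙xz; xy∙z≈xz∙y)
open import Data.Nat.Tactic.RingSolver using (solve-∀)
open import Data.Product using (_×_; _,_; ∃-syntax)
open import Data.Sum using (_⊎_; inj₁; inj₂)
open import Data.Vec using ([]; _∷_)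
open import Data.Vec.Properties using (≡-dec)
open import Function using (_∘_)
open import Relation.Binary.PropositionalEquality
  using (_≡_; refl; sym; trans; cong; cong₂; subst; module ≡-Reasoning)
open import Relation.Nullary using (Dec; yes; no; does; ¬_; ¬?; contradiction)
open import Relation.Unary using (Decidable)

private variable
  A B : Set
  n : ℕ

k≤n⇒nCk>0 : ∀ {n k} → k ≤ n → 0 < n C k
k≤n⇒nCk>0 {n}     {zero}  _         = z<s
k≤n⇒nCk>0 {suc n} {suc k} (s≤s k≤n) = begin-strict
  0                   <⟨ k≤n⇒nCk>0 k≤n ⟩
  n C k               ≤⟨ m≤m+n _ _ ⟩
  n C k + n C suc k   ≡⟨ nCk+nC[k+1]≡[n+1]C[k+1] n k ⟩
  suc n C suc k       ∎
  where open ≤-Reasoning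

nCk≤[1+n]Ck : ∀ n k → n C k ≤ suc n C k
nCk≤[1+n]Ck n zero    = ≤-refl
nCk≤[1+n]Ck n (suc k) = begin
  n C suc k           ≤⟨ m≤n+m _ _ ⟩
  n C k + n C suc k   ≡⟨ nCk+nC[k+1]≡[n+1]C[k+1] n k ⟩
  suc n C suc k       ∎
  where open ≤-Reasoning

m≤n⇒mCk≤nCk : ∀ {m n} k → m ≤ n → m C k ≤ n C k
m≤n⇒mCk≤nCk k m≤n = go (≤⇒≤′ m≤n)
  where
  go : ∀ {m n} → m ≤′ n → m C k ≤ n C k
  go ≤′-refl        = ≤-refl
  go (≤′-step m≤′n) = ≤-trans (go m≤′n) (nCk≤[1+n]Ck _ k)

1<nCk : ∀ {n k} → 0 < k → k < n → 1 < n C k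
1<nCk {suc n} {suc k} _ (s<s k<n) = begin-strict
  1                   <⟨ +-mono-≤ (k≤n⇒nCk>0 (<⇒≤ k<n)) (k≤n⇒nCk>0 k<n) ⟩
  n C k + n C suc k   ≡⟨ nCk+nC[k+1]≡[n+1]C[k+1] n k ⟩
  suc n C suc k       ∎
  where open ≤-Reasoning

[n∸m]Ck<nCk : ∀ {n m k} → 0 < m → 0 < k → k ≤ n → (n ∸ m) C k < n C k
[n∸m]Ck<nCk {suc n} {suc m} {suc k} _ _ (s≤s k≤n) = begin-strict
  (n ∸ m) C suc k      ≤⟨ m≤n⇒mCk≤nCk (suc k) (m∸n≤m n m) ⟩
  n C suc k            <⟨ m<n+m (n C suc k) (k≤n⇒nCk>0 k≤n) ⟩
  n C k + n C suc k    ≡⟨ nCk+nC[k+1]≡[n+1]C[k+1] n k ⟩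
  suc n C suc k        ∎
  where open ≤-Reasoning

nCk*[k!*[n∸k]!]≡n! : ∀ {n k} → k ≤ n → (n C k) * (k ! * (n ∸ k) !) ≡ n !
nCk*[k!*[n∸k]!]≡n! {n} {k} k≤n = begin
  (n C k) * (k ! * (n ∸ k) !)                  ≡⟨ cong (_* (k ! * (n ∸ k) !)) (nCk≡n!/k![n-k]! k≤n) ⟩
  n ! / (k ! * (n ∸ k) !) * (k ! * (n ∸ k) !) ≡⟨ m/n*n≡m (k![n∸k]!∣n! k≤n) ⟩
  n !                                        ∎
  where
  open ≡-Reasoning
  instance _ = k !* (n ∸ k) !≢0

nCk*[n∸k]Cj*[k!*j!*[n∸k∸j]!]≡n! : ∀ {n k j} → j + k ≤ n →
  (n C k) * ((n ∸ k) C j) * (k ! * j ! * (n ∸ k ∸ j) !) ≡ n !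
nCk*[n∸k]Cj*[k!*j!*[n∸k∸j]!]≡n! {n} {k} {j} j+k≤n = begin
  (n C k) * ((n ∸ k) C j) * (k ! * j ! * (n ∸ k ∸ j) !)
    ≡⟨ regroup (n C k) ((n ∸ k) C j) (k !) (j !) ((n ∸ k ∸ j) !) ⟩
  (n C k) * (k ! * (((n ∸ k) C j) * (j ! * (n ∸ k ∸ j) !)))
    ≡⟨ cong (λ x → (n C k) * (k ! * x)) (nCk*[k!*[n∸k]!]≡n! (m+n≤o⇒m≤o∸n j j+k≤n)) ⟩
  (n C k) * (k ! * (n ∸ k) !)
    ≡⟨ nCk*[k!*[n∸k]!]≡n! (m+n≤o⇒n≤o j j+k≤n) ⟩
  n ! ∎
  where
  open ≡-Reasoning
  regroup : ∀ c d x y z → c * d * (x * y * z) ≡ c * (x * (d * (y * z)))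
  regroup = solve-∀

nCk*[n∸k]Cj≡nCj*[n∸j]Ck : ∀ {n k j} → j + k ≤ n → (n C k) * ((n ∸ k) C j) ≡ (n C j) * ((n ∸ j) C k)
nCk*[n∸k]Cj≡nCj*[n∸j]Ck {n} {k} {j} j+k≤n = *-cancelʳ-≡ _ _ (k ! * j ! * (n ∸ k ∸ j) !) (begin
  (n C k) * ((n ∸ k) C j) * (k ! * j ! * (n ∸ k ∸ j) !)
    ≡⟨ nCk*[n∸k]Cj*[k!*j!*[n∸k∸j]!]≡n! {n} {k} {j} j+k≤n ⟩
  n !
    ≡⟨ nCk*[n∸k]Cj*[k!*j!*[n∸k∸j]!]≡n! {n} {j} {k} (subst (_≤ n) (+-comm j k) j+k≤n) ⟨
  (n C j) * ((n ∸ j) C k) * (j ! * k ! * (n ∸ j ∸ k) !)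
    ≡⟨ cong ((n C j) * ((n ∸ j) C k) *_) (cong₂ _*_ (*-comm (j !) (k !)) (cong _! ∸-swap)) ⟩
  (n C j) * ((n ∸ j) C k) * (k ! * j ! * (n ∸ k ∸ j) !) ∎)
  where
  open ≡-Reasoning
  ∸-swap : n ∸ j ∸ k ≡ n ∸ k ∸ j
  ∸-swap = trans (∸-+-assoc n j k) (trans (cong (n ∸_) (+-comm j k)) (sym (∸-+-assoc n k j)))
  instance
    _ = m*n≢0 (k ! * j !) ((n ∸ k ∸ j) !) {{m*n≢0 (k !) (j !) {{k !≢0}} {{j !≢0}}}} {{(n ∸ k ∸ j) !≢0}}

^-distribʳ-* : ∀ m n k → (m * n) ^ k ≡ m ^ k * n ^ k
^-distribʳ-* m n zero    = refl
^-distribʳ-* m n (suc k) =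
  trans (cong (m * n *_) (^-distribʳ-* m n k)) ([m*n]*[o*p]≡[m*o]*[n*p] m n (m ^ k) (n ^ k))

m!*[1+m]^k≤[m+k]! : ∀ m k → m ! * suc m ^ k ≤ (m + k) !
m!*[1+m]^k≤[m+k]! m zero    = ≤-reflexive (trans (*-identityʳ (m !)) (cong _! (sym (+-identityʳ m))))
m!*[1+m]^k≤[m+k]! m (suc k) = begin
  m ! * (suc m * suc m ^ k)  ≡⟨ x∙yz≈y∙xz (m !) (suc m) (suc m ^ k) ⟩
  suc m * (m ! * suc m ^ k)  ≤⟨ *-mono-≤ (s≤s (m≤m+n m k)) (m!*[1+m]^k≤[m+k]! m k) ⟩
  suc (m + k) * (m + k) !    ≡⟨ cong _! (+-suc m k) ⟨
  (m + suc k) !              ∎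
  where open ≤-Reasoning

[1+m]^k≤k!*[m+k]Cm : ∀ m k → suc m ^ k ≤ k ! * ((m + k) C m)
[1+m]^k≤k!*[m+k]Cm m k = *-cancelˡ-≤ (m !) {{m !≢0}} (begin
  m ! * suc m ^ k                             ≤⟨ m!*[1+m]^k≤[m+k]! m k ⟩
  (m + k) !                                   ≡⟨ nCk*[k!*[n∸k]!]≡n! (m≤m+n m k) ⟨
  ((m + k) C m) * (m ! * (m + k ∸ m) !)       ≡⟨ cong (λ i → ((m + k) C m) * (m ! * i !)) (m+n∸m≡n m k) ⟩
  ((m + k) C m) * (m ! * k !)                 ≡⟨ shuffle ((m + k) C m) (m !) (k !) ⟩
  m ! * (k ! * ((m + k) C m))                 ∎)
  where
  open ≤-Reasoning
  shuffle : ∀ c x y → c * (x * y) ≡ x * (y * c)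
  shuffle = solve-∀

module NegativeBinomial (p e : ℕ) where

  q : ℕ
  q = e + p

  -- partialSum M K = q ^ K * Σ_{k<K} C(M+k, M) x ^ k with x = p / q, a truncation of
  -- the series of (1 - x) ^ -(M+1).
  partialSum : ℕ → ℕ → ℕ
  partialSum M zero    = 0
  partialSum M (suc K) = q * partialSum M K + ((M + K) C M) * p ^ K * q

  geometric : ∀ K → e * partialSum 0 K + p ^ K * q ≡ q * q ^ K
  geometric zero    = identity e p
    where
    identity : ∀ e p → e * 0 + 1 * (e + p) ≡ (e + p) * 1
    identity = solve-∀
  geometric (suc K) = trans (identity e p (partialSum 0 K) (p ^ K)) (cong (q *_) (geometric K))
    where
    identity : ∀ e p H x →
      e * ((e + p) * H + 1 * x * (e + p)) + p * x * (e + p) ≡ (e + p) * (e * H + x * (e + p))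
    identity = solve-∀

  pascal-step : ∀ M K → e * partialSum (suc M) K + ((M + K) C suc M) * p ^ K * q ≡ q * partialSum M K
  pascal-step M zero = begin
    e * 0 + ((M + 0) C suc M) * 1 * q
      ≡⟨ cong (λ c → e * 0 + c * 1 * q) (k>n⇒nCk≡0 (s≤s (≤-reflexive (+-identityʳ M)))) ⟩
    e * 0 + 0 * 1 * q
      ≡⟨ identity e q ⟩
    q * 0 ∎
    where
    open ≡-Reasoning
    identity : ∀ e q → e * 0 + 0 * 1 * q ≡ q * 0
    identity = solve-∀
  pascal-step M (suc K) = begin
    e * (q * H₁ + ((suc M + K) C suc M) * x * q) + ((M + suc K) C suc M) * (p * x) * q
      ≡⟨ cong₂ (λ c d → e * (q * H₁ + c * x * q) + d * (p * x) * q) pascal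
               (trans (cong (_C suc M) (+-suc M K)) pascal) ⟩
    e * (q * H₁ + (c + c′) * x * q) + (c + c′) * (p * x) * q
      ≡⟨ identity e p H₁ c c′ x ⟩
    q * ((e * H₁ + c′ * x * q) + c * x * q)
      ≡⟨ cong (λ h → q * (h + c * x * q)) (pascal-step M K) ⟩
    q * (q * partialSum M K + c * x * q) ∎
    where
    open ≡-Reasoning
    H₁ = partialSum (suc M) K
    c = (M + K) C M
    c′ = (M + K) C suc M
    x = p ^ K
    pascal : suc (M + K) C suc M ≡ c + c′
    pascal = sym (nCk+nC[k+1]≡[n+1]C[k+1] (M + K) M)
    identity : ∀ e p H c c′ x →
      e * ((e + p) * H + (c + c′) * x * (e + p)) + (c + c′) * (p * x) * (e + p)
        ≡ (e + p) * ((e * H + c′ * x * (e + p)) + c * x * (e + p))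
    identity = solve-∀

  partialSum-bound : ∀ M K → partialSum M K * e ^ suc M ≤ q ^ K * q ^ suc M
  partialSum-bound zero K = begin
    partialSum 0 K * (e * 1)        ≡⟨ identity (partialSum 0 K) e ⟩
    e * partialSum 0 K              ≤⟨ m≤m+n _ _ ⟩
    e * partialSum 0 K + p ^ K * q  ≡⟨ geometric K ⟩
    q * q ^ K                       ≡⟨ identity (q ^ K) q ⟨
    q ^ K * (q * 1)                 ∎
    where
    open ≤-Reasoning
    identity : ∀ h e → h * (e * 1) ≡ e * h
    identity = solve-∀
  partialSum-bound (suc M) K = begin
    partialSum (suc M) K * (e * e ^ suc M)  ≡⟨ *-assoc (partialSum (suc M) K) e (e ^ suc M) ⟨
    partialSum (suc M) K * e * e ^ suc M    ≡⟨ cong (_* e ^ suc M) (*-comm (partialSum (suc M) K) e) ⟩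
    e * partialSum (suc M) K * e ^ suc M    ≤⟨ *-monoˡ-≤ (e ^ suc M) e*H₁≤q*H₀ ⟩
    q * partialSum M K * e ^ suc M          ≡⟨ *-assoc q (partialSum M K) (e ^ suc M) ⟩
    q * (partialSum M K * e ^ suc M)        ≤⟨ *-monoʳ-≤ q (partialSum-bound M K) ⟩
    q * (q ^ K * q ^ suc M)                 ≡⟨ x∙yz≈y∙xz q (q ^ K) (q ^ suc M) ⟩
    q ^ K * (q * q ^ suc M)                 ∎
    where
    open ≤-Reasoning
    e*H₁≤q*H₀ : e * partialSum (suc M) K ≤ q * partialSum M K
    e*H₁≤q*H₀ = ≤-trans (m≤m+n (e * partialSum (suc M) K) _) (≤-reflexive (pascal-step M K))

  module _ {M P Q : ℕ} (P/Q≤[1+M]p/q : P * q ≤ suc M * p * Q) where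

    term-bound : ∀ K → P ^ K * q ^ K ≤ ((M + K) C M) * p ^ K * (Q ^ K * K !)
    term-bound K = begin
      P ^ K * q ^ K
        ≡⟨ ^-distribʳ-* P q K ⟨
      (P * q) ^ K
        ≤⟨ ^-monoˡ-≤ K P/Q≤[1+M]p/q ⟩
      (suc M * p * Q) ^ K
        ≡⟨ trans (^-distribʳ-* (suc M * p) Q K) (cong (_* Q ^ K) (^-distribʳ-* (suc M) p K)) ⟩
      suc M ^ K * p ^ K * Q ^ K
        ≤⟨ *-monoˡ-≤ (Q ^ K) (*-monoˡ-≤ (p ^ K) ([1+m]^k≤k!*[m+k]Cm M K)) ⟩
      K ! * ((M + K) C M) * p ^ K * Q ^ K
        ≡⟨ shuffle (K !) ((M + K) C M) (p ^ K) (Q ^ K) ⟩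
      ((M + K) C M) * p ^ K * (Q ^ K * K !) ∎
      where
      open ≤-Reasoning
      shuffle : ∀ f c x y → f * c * x * y ≡ c * x * (y * f)
      shuffle = solve-∀

    expSeries-bound : ∀ K → expSeriesNum P Q K * q ^ K ≤ partialSum M K * (Q ^ K * K !)
    expSeries-bound zero    = z≤n
    expSeries-bound (suc K) = begin
      s * Q * (S + P ^ K) * (q * q ^ K)
        ≡⟨ distribute s Q q S (P ^ K) (q ^ K) ⟩
      s * Q * q * (S * q ^ K) + s * Q * q * (P ^ K * q ^ K)
        ≤⟨ +-mono-≤ (*-monoʳ-≤ (s * Q * q) (expSeries-bound K)) (*-monoʳ-≤ (s * Q * q) (term-bound K)) ⟩
      s * Q * q * (partialSum M K * F) + s * Q * q * (((M + K) C M) * p ^ K * F)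
        ≡⟨ collect s Q q (partialSum M K) ((M + K) C M) (p ^ K) (Q ^ K) (K !) ⟩
      (q * partialSum M K + ((M + K) C M) * p ^ K * q) * (Q * Q ^ K * (s * K !)) ∎
      where
      open ≤-Reasoning
      s = suc K
      S = expSeriesNum P Q K
      F = Q ^ K * K !
      distribute : ∀ s Q q S x y →
        s * Q * (S + x) * (q * y) ≡ s * Q * q * (S * y) + s * Q * q * (x * y)
      distribute = solve-∀
      collect : ∀ s Q q H c x y f →
        s * Q * q * (H * (y * f)) + s * Q * q * (c * x * (y * f))
          ≡ (q * H + c * x * q) * (Q * y * (s * f))
      collect = solve-∀

-- With x = p / (e + p):  exp (P/Q) ≤ exp ((1+M) x) ≤ (1 - x) ^ -(1+M) ≤ R, where the
-- middle step compares the two series termwise, (1+M) ^ k / k! ≤ C(M+k, M).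
expFracLeq-negBinomial : ∀ {p e M P Q R} → 0 < e → P * (e + p) ≤ suc M * p * Q →
  (e + p) ^ suc M ≤ R * e ^ suc M → ExpFracLeq P Q R
expFracLeq-negBinomial {p} {e} {M} {P} {Q} {R} 0<e P/Q≤[1+M]p/q q^[1+M]≤R*e^[1+M] K =
  *-cancelʳ-≤ _ _ (q ^ K * e ^ suc M) {{q^K*e^[1+M]≢0}} (begin
    S * (q ^ K * e ^ suc M)                  ≡⟨ *-assoc S (q ^ K) (e ^ suc M) ⟨
    S * q ^ K * e ^ suc M                    ≤⟨ *-monoˡ-≤ (e ^ suc M) (expSeries-bound P/Q≤[1+M]p/q K) ⟩
    partialSum M K * F * e ^ suc M           ≡⟨ xy∙z≈xz∙y (partialSum M K) F (e ^ suc M) ⟩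
    partialSum M K * e ^ suc M * F           ≤⟨ *-monoˡ-≤ F (partialSum-bound M K) ⟩
    q ^ K * q ^ suc M * F                    ≤⟨ *-monoˡ-≤ F (*-monoʳ-≤ (q ^ K) q^[1+M]≤R*e^[1+M]) ⟩
    q ^ K * (R * e ^ suc M) * F              ≡⟨ shuffle (q ^ K) R (e ^ suc M) (Q ^ K) (K !) ⟩
    R * Q ^ K * K ! * (q ^ K * e ^ suc M)    ∎)
  where
  open NegativeBinomial p e
  open ≤-Reasoning
  S = expSeriesNum P Q K
  F = Q ^ K * K !
  q^K*e^[1+M]≢0 : NonZero (q ^ K * e ^ suc M)
  q^K*e^[1+M]≢0 = m*n≢0 (q ^ K) (e ^ suc M)
    {{m^n≢0 q K {{>-nonZero (≤-trans 0<e (m≤m+n e p))}}}} {{m^n≢0 e (suc M) {{>-nonZero 0<e}}}}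
  shuffle : ∀ x R y u f → x * (R * y) * (u * f) ≡ R * u * f * (x * y)
  shuffle = solve-∀

sum-map-++ : ∀ (f : A → ℕ) xs ys → sum (map f (xs ++ ys)) ≡ sum (map f xs) + sum (map f ys)
sum-map-++ f xs ys = trans (cong sum (map-++ f xs ys)) (sum-++ (map f xs) (map f ys))

sum-map-∘ : ∀ (f : B → ℕ) (g : A → B) xs → sum (map f (map g xs)) ≡ sum (map (f ∘ g) xs)
sum-map-∘ f g xs = cong sum (sym (map-∘ xs))

sum-map-0 : ∀ (xs : List A) → sum (map (λ _ → 0) xs) ≡ 0
sum-map-0 []       = refl
sum-map-0 (x ∷ xs) = sum-map-0 xs

sum-map-+ : ∀ (f g : A → ℕ) xs → sum (map (λ x → f x + g x) xs) ≡ sum (map f xs) + sum (map g xs)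
sum-map-+ f g []       = refl
sum-map-+ f g (x ∷ xs) =
  trans (cong (f x + g x +_) (sum-map-+ f g xs)) (interchange (f x) (g x) (sum (map f xs)) (sum (map g xs)))
  where open import Algebra.Properties.CommutativeSemigroup +-commutativeSemigroup using (interchange)

∃-aboveAverage : ∀ (f : A → ℕ) {P : A → Set} xs → 0 < length xs → All P xs →
  ∃[ x ] (P x × sum (map f xs) ≤ length xs * f x)
∃-aboveAverage f (x ∷ [])     _ (px ∷ []) = x , px , ≤-refl
∃-aboveAverage f (x ∷ y ∷ ys) _ (px ∷ pys) with ∃-aboveAverage f (y ∷ ys) z<s pys
... | z , pz , avg with f x ≤? f z
...   | yes fx≤fz = z , pz , +-mono-≤ fx≤fz avg
...   | no  fx≰fz = x , px , +-monoʳ-≤ (f x) (≤-trans avg (*-monoʳ-≤ (length (y ∷ ys)) (<⇒≤ (≰⇒> fx≰fz))))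

OfSize : ℕ → Subset n → Set
OfSize k S = ∣ S ∣ ≡ k

subsetsOfSize : ∀ n → ℕ → List (Subset n)
subsetsOfSize n       zero    = [ ⊥ ]
subsetsOfSize zero    (suc k) = []
subsetsOfSize (suc n) (suc k) =
  map (inside ∷_) (subsetsOfSize n k) ++ map (outside ∷_) (subsetsOfSize n (suc k))

length-subsetsOfSize : ∀ n k → length (subsetsOfSize n k) ≡ n C k
length-subsetsOfSize n       zero    = refl
length-subsetsOfSize zero    (suc k) = refl
length-subsetsOfSize (suc n) (suc k) = begin
  length (map (inside ∷_) (subsetsOfSize n k) ++ map (outside ∷_) (subsetsOfSize n (suc k)))
    ≡⟨ length-++ (map (inside ∷_) (subsetsOfSize n k)) ⟩
  length (map (inside ∷_) (subsetsOfSize n k)) + length (map (outside ∷_) (subsetsOfSize n (suc k)))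
    ≡⟨ cong₂ _+_ (length-map _ (subsetsOfSize n k)) (length-map _ (subsetsOfSize n (suc k))) ⟩
  length (subsetsOfSize n k) + length (subsetsOfSize n (suc k))
    ≡⟨ cong₂ _+_ (length-subsetsOfSize n k) (length-subsetsOfSize n (suc k)) ⟩
  n C k + n C suc k
    ≡⟨ nCk+nC[k+1]≡[n+1]C[k+1] n k ⟩
  suc n C suc k ∎
  where open ≡-Reasoning

subsetsOfSize-ofSize : ∀ n k → All (OfSize k) (subsetsOfSize n k)
subsetsOfSize-ofSize n       zero    = ∣⊥∣≡0 n ∷ []
subsetsOfSize-ofSize zero    (suc k) = []
subsetsOfSize-ofSize (suc n) (suc k) =
  ++⁺ (map⁺ (All.map (cong suc) (subsetsOfSize-ofSize n k))) (map⁺ (subsetsOfSize-ofSize n (suc k)))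

∈-subsetsOfSize : ∀ (S : Subset n) → S ∈ subsetsOfSize n ∣ S ∣
∈-subsetsOfSize []            = here refl
∈-subsetsOfSize (inside ∷ S)  = ∈-++⁺ˡ (∈-map⁺ (inside ∷_) (∈-subsetsOfSize S))
∈-subsetsOfSize (outside ∷ S) with ∣ S ∣ | ∈-subsetsOfSize S
... | zero  | here S≡⊥ = here (cong (outside ∷_) S≡⊥)
... | suc k | S∈       = ∈-++⁺ʳ (map (inside ∷_) (subsetsOfSize _ k)) (∈-map⁺ (outside ∷_) S∈)

Disjoint : Subset n → Subset n → Set
Disjoint S T = S ∩ T ≡ ⊥

disjoint? : (S T : Subset n) → Dec (Disjoint S T)
disjoint? S T = ≡-dec Bool._≟_ (S ∩ T) ⊥

[disjoint] : Subset n → Subset n → ℕ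
[disjoint] S T = if does (disjoint? S T) then 1 else 0

[disjoint]-⊥ : ∀ (S : Subset n) → [disjoint] S ⊥ ≡ 1
[disjoint]-⊥ S with disjoint? S ⊥
... | yes _       = refl
... | no  S∩⊥≢⊥  = ⊥-elim (S∩⊥≢⊥ (∩-zeroʳ S))

sum-map-subsetsOfSize : ∀ (f : Subset (suc n) → ℕ) k →
  sum (map f (subsetsOfSize (suc n) (suc k)))
    ≡ sum (map (f ∘ (inside ∷_)) (subsetsOfSize n k)) + sum (map (f ∘ (outside ∷_)) (subsetsOfSize n (suc k)))
sum-map-subsetsOfSize {n} f k = begin
  sum (map f (map (inside ∷_) (subsetsOfSize n k) ++ map (outside ∷_) (subsetsOfSize n (suc k))))
    ≡⟨ sum-map-++ f (map (inside ∷_) (subsetsOfSize n k)) _ ⟩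
  sum (map f (map (inside ∷_) (subsetsOfSize n k))) + sum (map f (map (outside ∷_) (subsetsOfSize n (suc k))))
    ≡⟨ cong₂ _+_ (sum-map-∘ f _ (subsetsOfSize n k)) (sum-map-∘ f _ (subsetsOfSize n (suc k))) ⟩
  sum (map (f ∘ (inside ∷_)) (subsetsOfSize n k)) + sum (map (f ∘ (outside ∷_)) (subsetsOfSize n (suc k))) ∎
  where open ≡-Reasoning

#disjoint-subsetsOfSize : ∀ (S : Subset n) k → sum (map ([disjoint] S) (subsetsOfSize n k)) ≡ (n ∸ ∣ S ∣) C k
#disjoint-subsetsOfSize S             zero    = cong (_+ 0) ([disjoint]-⊥ S)
#disjoint-subsetsOfSize []            (suc k) = refl
#disjoint-subsetsOfSize {suc n} (inside ∷ S) (suc k) = begin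
  sum (map ([disjoint] (inside ∷ S)) (subsetsOfSize (suc n) (suc k)))
    ≡⟨ sum-map-subsetsOfSize ([disjoint] (inside ∷ S)) k ⟩
  sum (map (λ _ → 0) (subsetsOfSize n k)) + sum (map ([disjoint] S) (subsetsOfSize n (suc k)))
    ≡⟨ cong₂ _+_ (sum-map-0 (subsetsOfSize n k)) (#disjoint-subsetsOfSize S (suc k)) ⟩
  (n ∸ ∣ S ∣) C suc k ∎
  where open ≡-Reasoning
#disjoint-subsetsOfSize {suc n} (outside ∷ S) (suc k) = begin
  sum (map ([disjoint] (outside ∷ S)) (subsetsOfSize (suc n) (suc k)))
    ≡⟨ sum-map-subsetsOfSize ([disjoint] (outside ∷ S)) k ⟩
  sum (map ([disjoint] S) (subsetsOfSize n k)) + sum (map ([disjoint] S) (subsetsOfSize n (suc k)))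
    ≡⟨ cong₂ _+_ (#disjoint-subsetsOfSize S k) (#disjoint-subsetsOfSize S (suc k)) ⟩
  (n ∸ ∣ S ∣) C k + (n ∸ ∣ S ∣) C suc k
    ≡⟨ nCk+nC[k+1]≡[n+1]C[k+1] (n ∸ ∣ S ∣) k ⟩
  suc (n ∸ ∣ S ∣) C suc k
    ≡⟨ cong (_C suc k) (+-∸-assoc 1 (∣p∣≤n S)) ⟨
  (suc n ∸ ∣ S ∣) C suc k ∎
  where open ≡-Reasoning

firstIndex : {P : A → Set} → Decidable P → List A → ℕ
firstIndex P? []       = 0
firstIndex P? (x ∷ xs) = if does (P? x) then 0 else suc (firstIndex P? xs)

nthOr : A → List A → ℕ → A
nthOr d []       _       = d
nthOr d (x ∷ xs) zero    = x
nthOr d (x ∷ xs) (suc i) = nthOr d xs i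

firstIndex-spec : {P : A → Set} (P? : Decidable P) (d : A) {xs : List A} → Any P xs →
  firstIndex P? xs < length xs × P (nthOr d xs (firstIndex P? xs))
firstIndex-spec P? d {x ∷ xs} any with P? x | any
... | yes px | _          = z<s , px
... | no ¬px | here px    = contradiction px ¬px
... | no _   | there any′ with firstIndex-spec P? d any′
...   | i<|xs| , p = s<s i<|xs| , p

All-nthOr : {Q : A → Set} (d : A) {xs : List A} → All Q xs → ∀ {i} → i < length xs → Q (nthOr d xs i)
All-nthOr d (qx ∷ _)   {zero}  _           = qx
All-nthOr d (_  ∷ qxs) {suc i} (s<s i<|xs|) = All-nthOr d qxs i<|xs|

toBits : ℕ → ℕ → List Bool
toBits zero    i = []
toBits (suc c) i with 2 ^ c ≤? i
... | yes _ = true  ∷ toBits c (i ∸ 2 ^ c)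
... | no  _ = false ∷ toBits c i

fromBits : List Bool → ℕ
fromBits []           = 0
fromBits (true  ∷ bs) = 2 ^ length bs + fromBits bs
fromBits (false ∷ bs) = fromBits bs

length-toBits : ∀ c i → length (toBits c i) ≡ c
length-toBits zero    i = refl
length-toBits (suc c) i with 2 ^ c ≤? i
... | yes _ = cong suc (length-toBits c (i ∸ 2 ^ c))
... | no  _ = cong suc (length-toBits c i)

fromBits-toBits : ∀ c i → i < 2 ^ c → fromBits (toBits c i) ≡ i
fromBits-toBits zero    zero    _         = refl
fromBits-toBits zero    (suc i) (s<s ())
fromBits-toBits (suc c) i i<2^[1+c] with 2 ^ c ≤? i
... | yes 2^c≤i = begin
  2 ^ length (toBits c (i ∸ 2 ^ c)) + fromBits (toBits c (i ∸ 2 ^ c))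
    ≡⟨ cong₂ _+_ (cong (2 ^_) (length-toBits c (i ∸ 2 ^ c))) (fromBits-toBits c (i ∸ 2 ^ c) i∸2^c<2^c) ⟩
  2 ^ c + (i ∸ 2 ^ c)
    ≡⟨ m+[n∸m]≡n 2^c≤i ⟩
  i ∎
  where
  open ≡-Reasoning
  i∸2^c<2^c : i ∸ 2 ^ c < 2 ^ c
  i∸2^c<2^c = m<n+o⇒m∸n<o i (2 ^ c) {{m^n≢0 2 c}}
    (subst (i <_) (cong (2 ^ c +_) (+-identityʳ (2 ^ c))) i<2^[1+c])
... | no 2^c≰i = fromBits-toBits c i (≰⇒> 2^c≰i)

protocol-from-cover : ∀ {t a b} c (Ts : List (Subset t)) → length Ts ≤ 2 ^ c →
  All (OfSize b) Ts → (∀ S → OfSize a S → Any (Disjoint S) Ts) → Protocol t a b c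
protocol-from-cover {t} {a} {b} c Ts |Ts|≤2^c Ts-ofSize covers = alice , bob , correct
  where
  alice : Subset t → List Bool
  alice S = toBits c (firstIndex (disjoint? S) Ts)
  bob : List Bool → Subset t
  bob message = nthOr ⊥ Ts (fromBits message)
  correct : ∀ S → ∣ S ∣ ≡ a →
    (length (alice S) ≤ c) × (∣ bob (alice S) ∣ ≡ b) × (S ∩ bob (alice S) ≡ ⊥)
  correct S ∣S∣≡a with firstIndex-spec (disjoint? S) ⊥ (covers S ∣S∣≡a)
  ... | i<|Ts| , disjoint
    rewrite fromBits-toBits c (firstIndex (disjoint? S) Ts) (<-≤-trans i<|Ts| |Ts|≤2^c) =
    ≤-reflexive (length-toBits c _) , All-nthOr ⊥ Ts-ofSize i<|Ts| , disjoint

#disjoint : List (Subset n) → Subset n → ℕ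
#disjoint X T = sum (map (λ S → [disjoint] S T) X)

sum-#disjoint : ∀ {a} b (X : List (Subset n)) → All (OfSize a) X →
  sum (map (#disjoint X) (subsetsOfSize n b)) ≡ length X * ((n ∸ a) C b)
sum-#disjoint {n} b [] [] = sum-map-0 (subsetsOfSize n b)
sum-#disjoint {n} {a} b (S ∷ X) (refl ∷ X-ofSize) = begin
  sum (map (#disjoint (S ∷ X)) Bs)
    ≡⟨ sum-map-+ ([disjoint] S) (#disjoint X) Bs ⟩
  sum (map ([disjoint] S) Bs) + sum (map (#disjoint X) Bs)
    ≡⟨ cong₂ _+_ (#disjoint-subsetsOfSize S b) (sum-#disjoint b X X-ofSize) ⟩
  (n ∸ a) C b + length X * ((n ∸ a) C b) ∎
  where
  open ≡-Reasoning
  Bs = subsetsOfSize n b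

meets? : (T S : Subset n) → Dec (¬ Disjoint S T)
meets? T S = ¬? (disjoint? S T)

meeting : Subset n → List (Subset n) → List (Subset n)
meeting T = filter (meets? T)

length-meeting : ∀ (T : Subset n) X → length X ≡ #disjoint X T + length (meeting T X)
length-meeting T []      = refl
length-meeting T (S ∷ X) with disjoint? S T
... | yes _ = cong suc (length-meeting T X)
... | no  _ = trans (cong suc (length-meeting T X)) (sym (+-suc _ _))

unavoided : List (Subset n) → List (Subset n) → List (Subset n)
unavoided []       X = X
unavoided (T ∷ Ts) X = unavoided Ts (meeting T X)

∈-unavoided : ∀ {S : Subset n} Ts {X} → S ∈ X → S ∈ unavoided Ts X ⊎ Any (Disjoint S) Ts
∈-unavoided           []       S∈X = inj₁ S∈X
∈-unavoided {S = S} (T ∷ Ts) S∈X with disjoint? S T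
... | yes S∩T≡⊥ = inj₂ (here S∩T≡⊥)
... | no  S∩T≢⊥ with ∈-unavoided Ts (∈-filter⁺ (meets? T) S∈X S∩T≢⊥)
...   | inj₁ S∈U = inj₁ S∈U
...   | inj₂ any = inj₂ (there any)

module Greedy {t : ℕ} (a b : ℕ) (a+b≤t : a + b ≤ t) where

  N D E : ℕ
  N = t C a
  D = (t ∸ b) C a
  E = N ∸ D

  greedy-step : ∀ (X : List (Subset t)) → All (OfSize a) X →
    ∃[ T ] (OfSize b T × N * length (meeting T X) ≤ E * length X)
  greedy-step X X-ofSize
    with ∃-aboveAverage (#disjoint X) (subsetsOfSize t b) Bs-nonempty (subsetsOfSize-ofSize t b)
    where
    Bs-nonempty : 0 < length (subsetsOfSize t b)
    Bs-nonempty = subst (0 <_) (sym (length-subsetsOfSize t b)) (k≤n⇒nCk>0 (m+n≤o⇒n≤o a a+b≤t))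
  ... | T , T-ofSize , average = T , T-ofSize , N*|meeting|≤E*|X|
    where
    open ≤-Reasoning
    L = length X
    hits = #disjoint X T
    Cb = t C b
    L*[t∸a]Cb≤Cb*hits : L * ((t ∸ a) C b) ≤ Cb * hits
    L*[t∸a]Cb≤Cb*hits = begin
      L * ((t ∸ a) C b)                           ≡⟨ sum-#disjoint b X X-ofSize ⟨
      sum (map (#disjoint X) (subsetsOfSize t b)) ≤⟨ average ⟩
      length (subsetsOfSize t b) * hits           ≡⟨ cong (_* hits) (length-subsetsOfSize t b) ⟩
      Cb * hits                                   ∎
    D*L≤N*hits : D * L ≤ N * hits
    D*L≤N*hits = *-cancelˡ-≤ Cb {{>-nonZero (k≤n⇒nCk>0 (m+n≤o⇒n≤o a a+b≤t))}} (begin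
      Cb * (D * L)              ≡⟨ *-assoc Cb D L ⟨
      Cb * D * L                ≡⟨ cong (_* L) (nCk*[n∸k]Cj≡nCj*[n∸j]Ck {t} {b} {a} a+b≤t) ⟩
      N * ((t ∸ a) C b) * L     ≡⟨ *-assoc N _ L ⟩
      N * (((t ∸ a) C b) * L)   ≡⟨ cong (N *_) (*-comm _ L) ⟩
      N * (L * ((t ∸ a) C b))   ≤⟨ *-monoʳ-≤ N L*[t∸a]Cb≤Cb*hits ⟩
      N * (Cb * hits)           ≡⟨ x∙yz≈y∙xz N Cb hits ⟩
      Cb * (N * hits)           ∎)
    N*|meeting|≤E*|X| : N * length (meeting T X) ≤ E * L
    N*|meeting|≤E*|X| = subst (N * length (meeting T X) ≤_) (sym (*-distribʳ-∸ L N D)) (m+n≤o⇒m≤o∸n _ (begin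
      N * length (meeting T X) + D * L     ≤⟨ +-monoʳ-≤ _ D*L≤N*hits ⟩
      N * length (meeting T X) + N * hits  ≡⟨ +-comm _ (N * hits) ⟩
      N * hits + N * length (meeting T X)  ≡⟨ *-distribˡ-+ N hits _ ⟨
      N * (hits + length (meeting T X))    ≡⟨ cong (N *_) (length-meeting T X) ⟨
      N * L                                ∎))

  greedy : ∀ m (X : List (Subset t)) → All (OfSize a) X →
    ∃[ Ts ] (length Ts ≡ m × All (OfSize b) Ts × N ^ m * length (unavoided Ts X) ≤ E ^ m * length X)
  greedy zero    X _ = [] , refl , [] , ≤-refl
  greedy (suc m) X X-ofSize with greedy-step X X-ofSize
  ... | T , T-ofSize , step with greedy m (meeting T X) (filter⁺ (meets? T) X-ofSize)
  ...   | Ts , refl , Ts-ofSize , rest = T ∷ Ts , refl , T-ofSize ∷ Ts-ofSize , (begin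
    N * N ^ m * length (unavoided Ts (meeting T X))  ≡⟨ *-assoc N (N ^ m) _ ⟩
    N * (N ^ m * length (unavoided Ts (meeting T X))) ≤⟨ *-monoʳ-≤ N rest ⟩
    N * (E ^ m * length (meeting T X))               ≡⟨ x∙yz≈y∙xz N (E ^ m) _ ⟩
    E ^ m * (N * length (meeting T X))               ≤⟨ *-monoʳ-≤ (E ^ m) step ⟩
    E ^ m * (E * length X)                           ≡⟨ x∙yz≈y∙xz (E ^ m) E _ ⟩
    E * (E ^ m * length X)                           ≡⟨ *-assoc E (E ^ m) _ ⟨
    E * E ^ m * length X                             ∎)
    where
    open ≤-Reasoning

  greedy-cover : ∀ m → N * E ^ m < N ^ m →
    ∃[ Ts ] (length Ts ≡ m × All (OfSize b) Ts × (∀ S → OfSize a S → Any (Disjoint S) Ts))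
  greedy-cover m N*E^m<N^m with greedy m (subsetsOfSize t a) (subsetsOfSize-ofSize t a)
  ... | Ts , |Ts|≡m , Ts-ofSize , leftover = Ts , |Ts|≡m , Ts-ofSize , covers
    where
    nothing-left : ∀ U → N ^ m * length U ≤ E ^ m * length (subsetsOfSize t a) → U ≡ []
    nothing-left []      _ = refl
    nothing-left (_ ∷ U) N^m*|U|≤E^m*N = ⊥-elim (<⇒≱ N*E^m<N^m (begin
      N ^ m                               ≤⟨ m≤m*n (N ^ m) (suc (length U)) ⟩
      N ^ m * suc (length U)              ≤⟨ N^m*|U|≤E^m*N ⟩
      E ^ m * length (subsetsOfSize t a)  ≡⟨ cong (E ^ m *_) (length-subsetsOfSize t a) ⟩
      E ^ m * N                           ≡⟨ *-comm (E ^ m) N ⟩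
      N * E ^ m                           ∎))
      where open ≤-Reasoning
    covers : ∀ S → OfSize a S → Any (Disjoint S) Ts
    covers S ∣S∣≡a with ∈-unavoided Ts (subst (λ k → S ∈ subsetsOfSize t k) ∣S∣≡a (∈-subsetsOfSize S))
    ... | inj₁ S∈U = ⊥-elim (¬Any[] (subst (S ∈_) (nothing-left _ leftover) S∈U))
    ... | inj₂ any = any

  greedy-protocol : ∀ c m → N * E ^ m < N ^ m → m ≤ 2 ^ c → Protocol t a b c
  greedy-protocol c m N*E^m<N^m m≤2^c with greedy-cover m N*E^m<N^m
  ... | Ts , refl , Ts-ofSize , covers = protocol-from-cover c Ts m≤2^c Ts-ofSize covers

upcrossing : {P : ℕ → Set} → Decidable P → ¬ P 0 → ∀ n → P n → ∃[ m ] (¬ P m × P (suc m))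
upcrossing P? ¬P0 zero    P0      = contradiction P0 ¬P0
upcrossing P? ¬P0 (suc n) P[1+n] with P? n
... | yes Pn  = upcrossing P? ¬P0 n Pn
... | no  ¬Pn = n , ¬Pn , P[1+n]

n<2^n : ∀ n → n < 2 ^ n
n<2^n zero    = z<s
n<2^n (suc n) = +-mono-≤ (m^n>0 2 n) (≤-trans (n<2^n n) (m≤m+n (2 ^ n) 0))

∃2^c-between : ∀ m → ∃[ c ] (suc (suc m) ≤ 2 ^ c × 2 ^ c ≤ 2 * suc m)
∃2^c-between m
  with upcrossing (λ k → suc (suc m) ≤? 2 ^ k) (λ { (s≤s ()) }) (suc (suc m)) (<⇒≤ (n<2^n (suc (suc m))))
... | k , 2^k<2+m , 2+m≤2^[1+k] = suc k , 2+m≤2^[1+k] , *-monoʳ-≤ 2 (s≤s⁻¹ (≰⇒> 2^k<2+m))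

bernoulli : ∀ E n → E ^ suc n + suc n * E ^ n ≤ suc E ^ suc n
bernoulli E zero    = ≤-reflexive (identity E)
  where
  identity : ∀ E → E * 1 + 1 * 1 ≡ (1 + E) * 1
  identity = solve-∀
bernoulli E (suc n) = begin
  E * (E * x) + (2 + n) * (E * x)                ≤⟨ m≤m+n _ ((1 + n) * x) ⟩
  E * (E * x) + (2 + n) * (E * x) + (1 + n) * x  ≡⟨ identity E n x ⟩
  (1 + E) * (E * x + (1 + n) * x)                ≤⟨ *-monoʳ-≤ (suc E) (bernoulli E n) ⟩
  (1 + E) * suc E ^ suc n                        ∎
  where
  open ≤-Reasoning
  x = E ^ n
  identity : ∀ E n x → E * (E * x) + (2 + n) * (E * x) + (1 + n) * x ≡ (1 + E) * (E * x + (1 + n) * x)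
  identity = solve-∀

∃-crossing : ∀ {N D} → 0 < D → D < N →
  ∃[ M ] (N ^ suc M ≤ N * (N ∸ D) ^ suc M × N * (N ∸ D) ^ suc (suc M) < N ^ suc (suc M))
∃-crossing {N} {D} 0<D D<N with upcrossing (λ m → N * E ^ m <? N ^ m) ¬P0 (suc n₀) P[1+n₀]
  where
  E = N ∸ D
  0<E : 0 < E
  0<E = m<n⇒0<n∸m D<N
  1+E≤N : suc E ≤ N
  1+E≤N = ∸-monoʳ-< 0<D (<⇒≤ D<N)
  ¬P0 : ¬ (N * 1 < 1)
  ¬P0 = ≤⇒≯ (≤-trans (≤-<-trans z≤n D<N) (≤-reflexive (sym (*-identityʳ N))))
  n₀ = N * E
  P[1+n₀] : N * (E * E ^ n₀) < N ^ suc n₀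
  P[1+n₀] = begin-strict
    N * (E * E ^ n₀)          ≡⟨ *-assoc N E (E ^ n₀) ⟨
    n₀ * E ^ n₀               <⟨ *-monoˡ-< (E ^ n₀) {{m^n≢0 E n₀ {{>-nonZero 0<E}}}} (m≤n+m (suc n₀) E) ⟩
    (E + suc n₀) * E ^ n₀     ≡⟨ *-distribʳ-+ (E ^ n₀) E (suc n₀) ⟩
    E ^ suc n₀ + suc n₀ * E ^ n₀ ≤⟨ bernoulli E n₀ ⟩
    suc E ^ suc n₀            ≤⟨ ^-monoˡ-≤ (suc n₀) 1+E≤N ⟩
    N ^ suc n₀                ∎
    where open ≤-Reasoning
... | zero  , _ , N*E^1<N^1 = contradiction N*E^1<N^1
        (≤⇒≯ (*-monoʳ-≤ N (*-monoˡ-≤ 1 (m<n⇒0<n∸m D<N))))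
... | suc M , N*E^[1+M]≮N^[1+M] , N*E^[2+M]<N^[2+M] = M , ≮⇒≥ N*E^[1+M]≮N^[1+M] , N*E^[2+M]<N^[2+M]

expFracLeq-quarter : ∀ {N} → 2 ≤ N → ExpFracLeq (1 * N) (4 * N) N
expFracLeq-quarter {N} 2≤N =
  expFracLeq-negBinomial {p = 1} {e = 1} {M = 0} {P = 1 * N} {Q = 4 * N} {R = N}
    z<s N/4N≤1/2 (subst (2 ≤_) (sym (*-identityʳ N)) 2≤N)
  where
  N/4N≤1/2 : 1 * N * (1 + 1) ≤ 1 * 1 * (4 * N)
  N/4N≤1/2 = begin
    1 * N * (1 + 1)    ≡⟨ identityˡ N ⟩
    2 * N              ≤⟨ *-monoˡ-≤ N {2} {4} (s≤s (s≤s z≤n)) ⟩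
    4 * N              ≡⟨ identityʳ N ⟩
    1 * 1 * (4 * N)    ∎
    where
    open ≤-Reasoning
    identityˡ : ∀ N → 1 * N * (1 + 1) ≡ 2 * N
    identityˡ = solve-∀
    identityʳ : ∀ N → 4 * N ≡ 1 * 1 * (4 * N)
    identityʳ = solve-∀

expFracLeq-crossing : ∀ {N D} M c → D < N → N ^ suc M ≤ N * (N ∸ D) ^ suc M → 2 ^ c ≤ 2 * suc M →
  ExpFracLeq (2 ^ c * D) (4 * N) N
expFracLeq-crossing {N} {D} M c D<N N^[1+M]≤N*E^[1+M] 2^c≤2+2M =
  expFracLeq-negBinomial {p = D} {e = N ∸ D} {M = M} {P = 2 ^ c * D} {Q = 4 * N} {R = N}
    (m<n⇒0<n∸m D<N) P/Q≤[1+M]p/q [E+D]^[1+M]≤N*E^[1+M]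
  where
  open ≤-Reasoning
  E+D≡N : N ∸ D + D ≡ N
  E+D≡N = m∸n+n≡m (<⇒≤ D<N)
  [E+D]^[1+M]≤N*E^[1+M] : (N ∸ D + D) ^ suc M ≤ N * (N ∸ D) ^ suc M
  [E+D]^[1+M]≤N*E^[1+M] = subst (λ q → q ^ suc M ≤ N * (N ∸ D) ^ suc M) (sym E+D≡N) N^[1+M]≤N*E^[1+M]
  P/Q≤[1+M]p/q : 2 ^ c * D * (N ∸ D + D) ≤ suc M * D * (4 * N)
  P/Q≤[1+M]p/q = begin
    2 ^ c * D * (N ∸ D + D)  ≡⟨ cong (2 ^ c * D *_) E+D≡N ⟩
    2 ^ c * D * N            ≤⟨ *-monoˡ-≤ N (*-monoˡ-≤ D 2^c≤4+4M) ⟩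
    4 * suc M * D * N        ≡⟨ regroup (suc M) D N ⟩
    suc M * D * (4 * N)      ∎
    where
    2^c≤4+4M : 2 ^ c ≤ 4 * suc M
    2^c≤4+4M = ≤-trans 2^c≤2+2M (*-monoˡ-≤ (suc M) {2} {4} (s≤s (s≤s z≤n)))
    regroup : ∀ m d n → 4 * m * d * n ≡ m * d * (4 * n)
    regroup = solve-∀

lemma4p2 : (t a b : ℕ) → 0 < t → 0 < a + b → a + b ≤ t → 0 < a → a < t →
    ∃[ c ] (BoundHolds t a b c × Protocol t a b c)
lemma4p2 t a zero _ _ _ 0<a a<t =
  0 , expFracLeq-quarter (1<nCk 0<a a<t) ,
  protocol-from-cover 0 [ ⊥ ] ≤-refl (∣⊥∣≡0 t ∷ []) (λ S _ → here (∩-zeroʳ S))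
lemma4p2 t a b@(suc _) _ _ a+b≤t 0<a _
  with [n∸m]Ck<nCk z<s 0<a (m+n≤o⇒m≤o a a+b≤t)
... | D<N with ∃-crossing (k≤n⇒nCk>0 (m+n≤o⇒m≤o∸n a a+b≤t)) D<N
... | M , N^[1+M]≤N*E^[1+M] , N*E^[2+M]<N^[2+M] with ∃2^c-between M
... | c , 2+M≤2^c , 2^c≤2+2M =
  c , expFracLeq-crossing M c D<N N^[1+M]≤N*E^[1+M] 2^c≤2+2M ,
  Greedy.greedy-protocol a b a+b≤t c (suc (suc M)) N*E^[2+M]<N^[2+M] 2+M≤2^c
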